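{- Let $\Gamma\vdash A$ be a normalized LJB-sequent. Then for every scheme $\pi$ generated by the scheme grammar from the non-terminal $s_{\Gamma\vdash A}$, the judgement $\Gamma\vdash\pi:A$ is derivable in LJB with schemes.
   Context: Formulas of minimal predicate logic are built from atomic formulas with $\to$ and $\forall$. An LJB-context is a finite multiset of items; an item is a formula or an expression $[\Gamma]_V$ with $V$ a finite set of term variables (bound by the bracket) and $\Gamma$ an LJB-context. An LJB-sequent is $\Gamma\vdash A$; formulas are not taken modulo $\alpha$-equivalence. It is normalized if all its bound variables (by quantifiers or brackets) are pairwise distinct and distinct from its free variables. Cleaning rules (applicable anywhere, also inside brackets): $[I,\Gamma]_V\to I,[\Gamma]_V$ if $FV(I)\cap V=\emptyset$; $[\ ]_V\to\emptyset$; $I,I\to I$; $\Gamma{\downarrow}$ is the normal form of $\Gamma$ obtained by a fixed deterministic strategy. A fixed injective map assigns to each formula $C$ a proof variable, its canonical variable. LJB with schemes: (L$\to$) if $\Gamma=\Gamma_1,[\Gamma_2,[\dots\Gamma_{i-1},[\Gamma_i,A_1\to\dots\to A_n\to P]_{V_{i-1}}\dots]_{V_2}]_{V_1}$ ($i\ge 1$), $P$ atomic with no free variable in $V_1\cup\dots\cup V_{i-1}$, $\Gamma^*=([\dots[[\Gamma_1]_{V_1},\Gamma_2]_{V_2},\dots,\Gamma_{i-1}]_{V_{i-1}},\Gamma_i,A_1\to\dots\to A_n\to P)$, and $\Gamma^*{\downarrow}\vdash\pi_j:A_j$ for all $j$, then $\Gamma\vdash(\alpha\,\pi_1\dots\pi_n):P$,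 $\alpha$ the canonical variable of $A_1\to\dots\to A_n\to P$; (R$\forall$) if $[\Gamma]_V{\downarrow}\vdash\pi:A$ with $V$ the set of all variables bound in $\forall x\,A$ (including $x$), then $\Gamma\vdash\lambda x\,\pi:\forall x\,A$; (R$\to$) if $(\Gamma,A){\downarrow}\vdash\pi:B$ then $\Gamma\vdash\lambda\alpha{:}A\,\pi:A\to B$, $\alpha$ the canonical variable of $A$. Scheme grammar: one non-terminal $s_S$ for each LJB-sequent $S$ reachable from $\Gamma\vdash A$, with productions $s_{\Gamma\vdash P}\to(\alpha\,s_{\Gamma^*{\downarrow}\vdash A_1}\dots s_{\Gamma^*{\downarrow}\vdash A_n})$ for every decomposition of $\Gamma$ and $\alpha$ as in (L$\to$); $s_{\Gamma\vdash\forall xA}\to\lambda x\,s_{[\Gamma]_V{\downarrow}\vdash A}$ ($V$ as in (R$\forall$)); $s_{\Gamma\vdash A\to B}\to\lambda\alpha{:}A\,s_{(\Gamma,A){\downarrow}\vdash B}$ ($\alpha$ canonical for $A$). A scheme generated in $s_S$ is a terminal word derivable from $s_S$. -}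

module Defs where

open import Data.Nat using (ℕ)
import Data.List
open import Data.List using (List; []; _∷_; _++_)
open import Data.List.Relation.Unary.Any using (Any)
open import Data.List.Membership.Propositional using (_∈_; _∉_)
open import Data.List.Relation.Unary.Unique.Propositional using (Unique)
open import Data.List.Relation.Binary.Permutation.Propositional using (_↭_)
open import Data.List.Relation.Binary.Pointwise using (Pointwise)
open import Data.Product using (Σ; _×_)
open import Relation.Binary.PropositionalEquality using (_≡_; _≢_)
open import Relation.Binary.Construct.Closure.ReflexiveTransitive using (Star)
open import Relation.Nullary using (¬_)

data Term : Set where
  var : ℕ → Term
  fun : ℕ → List Term → Term

data Formula : Set where
  atom : ℕ → List Term → Formula
  _⇒_  : Formula → Formula → Formula
  ∀'   : ℕ → Formula → Formula        -- ∀x A  (not modulo α)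

infixr 5 _⇒_

_⇛_ : List Formula → Formula → Formula
[] ⇛ B = B
(A ∷ As) ⇛ B = A ⇒ (As ⇛ B)

-- LJB-contexts: finite multisets of items, represented as lists
-- (taken up to permutation where it matters, see _↭_ below).
-- A bracket [Γ]_V carries its finite set V of bound variables as a list.
data Item : Set where
  fm : Formula → Item
  br : List ℕ → List Item → Item

Ctx : Set
Ctx = List Item

data _∈t_ (x : ℕ) : Term → Set where
  here : x ∈t var x
  arg  : ∀ {f ts} → Any (x ∈t_) ts → x ∈t fun f ts

data _∈F_ (x : ℕ) : Formula → Set where
  atm  : ∀ {p ts} → Any (x ∈t_) ts → x ∈F atom p ts
  impl : ∀ {A B} → x ∈F A → x ∈F (A ⇒ B)
  impr : ∀ {A B} → x ∈F B → x ∈F (A ⇒ B)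
  all  : ∀ {y A} → x ≢ y → x ∈F A → x ∈F ∀' y A

data _∈I_ (x : ℕ) : Item → Set where
  fm : ∀ {A} → x ∈F A → x ∈I fm A
  br : ∀ {V Γ} → x ∉ V → Any (x ∈I_) Γ → x ∈I br V Γ

_∈C_ : ℕ → Ctx → Set
x ∈C Γ = Any (x ∈I_) Γ

bvF : Formula → List ℕ
bvF (atom _ _) = []
bvF (A ⇒ B) = bvF A ++ bvF B
bvF (∀' x A) = x ∷ bvF A

mutual
  bvI : Item → List ℕ
  bvI (fm A) = bvF A
  bvI (br V Γ) = V ++ bvC Γ

  bvC : Ctx → List ℕ
  bvC [] = []
  bvC (I ∷ Γ) = bvI I ++ bvC Γ

Normalized : Ctx → Formula → Set
Normalized Γ A =
  Unique (bvC Γ ++ bvF A) ×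
  (∀ x → x ∈ (bvC Γ ++ bvF A) → ¬ (x ∈C Γ) × ¬ (x ∈F A))

infix 4 _⇝_
data _⇝_ : Ctx → Ctx → Set where
  pull   : ∀ {V Γ I Γ' Δ} → Γ ↭ (I ∷ Γ') → (∀ x → x ∈I I → x ∉ V) →
           (br V Γ ∷ Δ) ⇝ (I ∷ br V Γ' ∷ Δ)
  drop   : ∀ {V Δ} → (br V [] ∷ Δ) ⇝ Δ
  dup    : ∀ {I Δ} → (I ∷ I ∷ Δ) ⇝ (I ∷ Δ)
  inside : ∀ {V Γ Γ' Δ} → Γ ⇝ Γ' → (br V Γ ∷ Δ) ⇝ (br V Γ' ∷ Δ)
  perm   : ∀ {Γ Γ₁ Γ₂} → Γ ↭ Γ₁ → Γ₁ ⇝ Γ₂ → Γ ⇝ Γ₂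

CleanNormal : Ctx → Set
CleanNormal Γ = ∀ Δ → ¬ (Γ ⇝ Δ)

-- `clean` computes a normal form Γ↓ of Γ w.r.t. the cleaning rules
-- (it is a function, hence a fixed deterministic strategy).
IsCleaning : (Ctx → Ctx) → Set
IsCleaning clean =
  ∀ Γ → (Σ Ctx λ Γ' → Star _⇝_ Γ Γ' × Γ' ↭ clean Γ) × CleanNormal (clean Γ)

-- Decomposition of Γ for (L→):
-- Γ = Γ₁,[Γ₂,[…Γᵢ₋₁,[Γᵢ,F]_{Vᵢ₋₁}…]_{V₂}]_{V₁}, producing
-- Γ* = ([…[[Γ₁]_{V₁},Γ₂]_{V₂},…,Γᵢ₋₁]_{Vᵢ₋₁},Γᵢ,F) and V₁ ∪ … ∪ Vᵢ₋₁.
-- `Walk acc Γ F Γ* Vs`: acc is the already re-bracketed outer part.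

data Walk : Ctx → Ctx → Formula → Ctx → List ℕ → Set where
  stop  : ∀ {acc Γ F Γᵢ} → Γ ↭ (fm F ∷ Γᵢ) →
          Walk acc Γ F (acc ++ Γᵢ ++ (fm F ∷ [])) []
  enter : ∀ {acc Γ V Γ' Γr F Γ* Vs} → Γ ↭ (br V Γ' ∷ Γr) →
          Walk (br V (acc ++ Γr) ∷ []) Γ' F Γ* Vs →
          Walk acc Γ F Γ* (V ++ Vs)

Decomp : Ctx → Formula → Ctx → List ℕ → Set
Decomp Γ F Γ* Vs = Walk [] Γ F Γ* Vs

data Scheme : Set where
  app  : ℕ → List Scheme → Scheme
  lamT : ℕ → Scheme → Scheme
  lamP : ℕ → Formula → Scheme → Scheme

-- Sentential forms of the scheme grammar: schemes with non-terminals s_{Γ⊢A}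
data SF : Set where
  app  : ℕ → List SF → SF
  lamT : ℕ → SF → SF
  lamP : ℕ → Formula → SF → SF
  nt   : Ctx → Formula → SF

module LJB (clean : Ctx → Ctx) (canon : Formula → ℕ) where

  infix 3 _⊢_∶_
  data _⊢_∶_ : Ctx → Scheme → Formula → Set where
    L→ : ∀ {Γ F Γ* Vs As p ts πs} →
         Decomp Γ F Γ* Vs → F ≡ (As ⇛ atom p ts) →
         (∀ x → x ∈F atom p ts → x ∉ Vs) →
         Pointwise (λ A π → clean Γ* ⊢ π ∶ A) As πs →
         Γ ⊢ app (canon F) πs ∶ atom p ts
    R∀ : ∀ {Γ x A π} →
         clean (br (bvF (∀' x A)) Γ ∷ []) ⊢ π ∶ A →
         Γ ⊢ lamT x π ∶ ∀' x A
    R→ : ∀ {Γ A B π} →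
         clean (fm A ∷ Γ) ⊢ π ∶ B →
         Γ ⊢ lamP (canon A) A π ∶ (A ⇒ B)

  data Prod : Ctx → Formula → SF → Set where
    pL→ : ∀ {Γ F Γ* Vs As p ts} →
          Decomp Γ F Γ* Vs → F ≡ (As ⇛ atom p ts) →
          (∀ x → x ∈F atom p ts → x ∉ Vs) →
          Prod Γ (atom p ts) (app (canon F) (Data.List.map (nt (clean Γ*)) As))
    p∀  : ∀ {Γ x A} →
          Prod Γ (∀' x A) (lamT x (nt (clean (br (bvF (∀' x A)) Γ ∷ [])) A))
    p→  : ∀ {Γ A B} →
          Prod Γ (A ⇒ B) (lamP (canon A) A (nt (clean (fm A ∷ Γ)) B))

  data Gen : SF → Scheme → Set where
    nt   : ∀ {Γ A rhs π} → Prod Γ A rhs → Gen rhs π → Gen (nt Γ A) π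
    app  : ∀ {α ss πs} → Pointwise Gen ss πs → Gen (app α ss) (app α πs)
    lamT : ∀ {x s π} → Gen s π → Gen (lamT x s) (lamT x π)
    lamP : ∀ {α A s π} → Gen s π → Gen (lamP α A s) (lamP α A π)

Derivable : (Ctx → Ctx) → (Formula → ℕ) → Ctx → Scheme → Formula → Set
Derivable clean canon Γ π A = LJB._⊢_∶_ clean canon Γ π A

Generated : (Ctx → Ctx) → (Formula → ℕ) → Ctx → Formula → Scheme → Set
Generated clean canon Γ A π = LJB.Gen clean canon (nt Γ A) π

{-# OPTIONS --safe #-}
module Submission where

open import Defs
open import Data.Nat using (ℕ)
open import Data.List using ([]; _∷_; map)
open import Data.List.Relation.Binary.Pointwise using (Pointwise; []; _∷_)
open import Relation.Binary.PropositionalEquality using (_≡_)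
open import Function.Definitions using (Injective)

-- Each production of the scheme grammar is the corresponding LJB rule read
-- bottom-up, with the premises' contexts computed by the same `clean`, so a
-- derivation of π from s_{Γ⊢A} is turned into a typing derivation by
-- induction on the grammar derivation.

module _ (clean : Ctx → Ctx) (canon : Formula → ℕ) where
  open LJB clean canon

  mutual
    generated⇒⊢ : ∀ {Γ A π} → Gen (nt Γ A) π → Γ ⊢ π ∶ A
    generated⇒⊢ (nt (pL→ decomp As⇛P P-free) (app premises)) =
      L→ decomp As⇛P P-free (pointwise-generated⇒⊢ premises)
    generated⇒⊢ (nt p∀ (lamT body)) = R∀ (generated⇒⊢ body)
    generated⇒⊢ (nt p→ (lamP body)) = R→ (generated⇒⊢ body)

    pointwise-generated⇒⊢ : ∀ {Δ As πs} → Pointwise Gen (map (nt Δ) As) πs →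
                            Pointwise (λ A π → Δ ⊢ π ∶ A) As πs
    pointwise-generated⇒⊢ {As = []}    []       = []
    pointwise-generated⇒⊢ {As = _ ∷ _} (g ∷ gs) =
      generated⇒⊢ g ∷ pointwise-generated⇒⊢ gs

proposition2 : (clean : Ctx → Ctx) (canon : Formula → ℕ) →
    IsCleaning clean → Injective _≡_ _≡_ canon →
    (Γ : Ctx) (A : Formula) → Normalized Γ A →
    (π : Scheme) → Generated clean canon Γ A π →
    Derivable clean canon Γ π A
proposition2 clean canon _ _ _ _ _ _ = generated⇒⊢ clean canon
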